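{- Let $\mathcal{E}_0,\mathcal{E}_1,\mathcal{E}_2$ be Boolean equation systems, let $(\sigma X = f)$ be an equation with $\sigma\in\{\mu,\nu\}$, and let $\sigma'\in\{\mu,\nu\}$ be an arbitrary fixed-point sign, such that the concatenations below are well-formed. If $\mathrm{occ}(f) \cap \mathrm{bnd}((\sigma X = f)\,\mathcal{E}_1\,\mathcal{E}_2) = \emptyset$, then for all environments $\eta$: \[ [\![\mathcal{E}_0\,(\sigma X = f)\,\mathcal{E}_1\,\mathcal{E}_2]\!]\eta = [\![\mathcal{E}_0\,\mathcal{E}_1\,(\sigma' X = f)\,\mathcal{E}_2]\!]\eta. \]
   Context: Fix a set $\mathcal{X}$ of proposition variables. Proposition formulae are generated by $f,g ::= \mathsf{true} \mid \mathsf{false} \mid X \mid f\vee g \mid f\wedge g$ with $X\in\mathcal{X}$. A Boolean equation system (BES) is either the empty system $\epsilon$ or $(\sigma X = f)\,\mathcal{E}$ with $\sigma\in\{\mu,\nu\}$ and $\mathcal{E}$ a BES; juxtaposition denotes concatenation. $\mathrm{bnd}(\mathcal{E})$ is the set of variables occurring on the left-hand side of an equation of $\mathcal{E}$; $\mathrm{occ}(f)$ is the set of variables occurring in $f$. A BES is well-formed if each variable is the left-hand side of at most one equation. An environment is a map $\eta:\mathcal{X}\to\{\mathsf{true},\mathsf{false}\}$; $\eta[X:=b]$ is $\eta$ updated at $X$. Formulae are interpreted as usual: $[\![c]\!]\eta=c$, $[\![X]\!]\eta=\eta(X)$, $[\![f\vee g]\!]\eta=[\![f]\!]\eta\vee[\![g]\!]\eta$,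 $[\![f\wedge g]\!]\eta=[\![f]\!]\eta\wedge[\![g]\!]\eta$. The solution of a BES is the environment defined by $[\![\epsilon]\!]\eta=\eta$, $[\![(\mu X=f)\,\mathcal{E}]\!]\eta = [\![\mathcal{E}]\!](\eta[X:=[\![f]\!]([\![\mathcal{E}]\!](\eta[X:=\mathsf{false}]))])$ and $[\![(\nu X=f)\,\mathcal{E}]\!]\eta = [\![\mathcal{E}]\!](\eta[X:=[\![f]\!]([\![\mathcal{E}]\!](\eta[X:=\mathsf{true}]))])$. -}

module Defs where

open import Data.Nat using (ℕ; _≟_)
open import Data.Bool using (Bool; true; false; _∨_; _∧_; if_then_else_)
open import Data.List using (List; []; _∷_; _++_; map)
open import Data.List.Relation.Unary.Unique.Propositional using (Unique)
open import Relation.Nullary.Decidable using (⌊_⌋)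

-- Proposition variables: 𝒳 is taken to be ℕ (a countable set with decidable equality).
Var : Set
Var = ℕ

data Formula : Set where
  ftrue  : Formula
  ffalse : Formula
  fvar   : Var → Formula
  _∨ᶠ_   : Formula → Formula → Formula
  _∧ᶠ_   : Formula → Formula → Formula

data Sign : Set where
  μ ν : Sign

record Equation : Set where
  constructor eqn
  field
    sign : Sign
    lhs  : Var
    rhs  : Formula

-- A BES is a finite sequence of equations; ε = [], (σX=f) ℰ = eqn σ X f ∷ ℰ,
-- juxtaposition = _++_.
BES : Set
BES = List Equation

occ : Formula → List Var
occ ftrue     = []
occ ffalse    = []
occ (fvar X)  = X ∷ []
occ (f ∨ᶠ g)  = occ f ++ occ g
occ (f ∧ᶠ g)  = occ f ++ occ g

bnd : BES → List Var
bnd = map Equation.lhs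

WellFormed : BES → Set
WellFormed ℰ = Unique (bnd ℰ)

Env : Set
Env = Var → Bool

_[_≔_] : Env → Var → Bool → Env
(η [ X ≔ b ]) Y = if ⌊ Y ≟ X ⌋ then b else η Y

⟦_⟧ᶠ : Formula → Env → Bool
⟦ ftrue  ⟧ᶠ η = true
⟦ ffalse ⟧ᶠ η = false
⟦ fvar X ⟧ᶠ η = η X
⟦ f ∨ᶠ g ⟧ᶠ η = ⟦ f ⟧ᶠ η ∨ ⟦ g ⟧ᶠ η
⟦ f ∧ᶠ g ⟧ᶠ η = ⟦ f ⟧ᶠ η ∧ ⟦ g ⟧ᶠ η

init : Sign → Bool
init μ = false
init ν = true

⟦_⟧ : BES → Env → Env
⟦ [] ⟧ η = η
⟦ eqn σ X f ∷ ℰ ⟧ η = ⟦ ℰ ⟧ (η [ X ≔ ⟦ f ⟧ᶠ (⟦ ℰ ⟧ (η [ X ≔ init σ ])) ])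

module Submission where

-- If no variable of f is bound by  (σ X = f) ℰ₁ ℰ₂,  then solving the equation
-- for X never consults the rest of the system: X simply receives the value
-- ⟦ f ⟧ η of f in the incoming environment.  So its position and its sign are
-- irrelevant.
-- The theorem follows: both  (σ X = f) ℰ₁ ℰ₂  and  ℰ₁ (σ′ X = f) ℰ₂  solve to
-- ⟦ ℰ₁ ℰ₂ ⟧ (η [ X ≔ ⟦ f ⟧ η ]), and then ℰ₀ is prepended.

open import Defs
open import Data.List using ([]; _∷_; _++_)
open import Data.List.Membership.Propositional using (_∈_; _∉_)
open import Relation.Binary.PropositionalEquality using (_≡_)

open import Data.Bool using (Bool; _∨_; _∧_)
open import Data.Nat using (_≟_)
open import Data.Empty using (⊥-elim)
open import Data.List.Membership.Propositional.Properties using (∈-++⁺ˡ; ∈-++⁺ʳ)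
open import Data.List.Relation.Unary.Any using (here; there)
open import Data.List.Relation.Unary.All.Properties using (All¬⇒¬Any)
open import Data.List.Relation.Unary.AllPairs using (_∷_)
open import Relation.Binary.PropositionalEquality
  using (_≗_; refl; sym; trans; cong; cong₂; subst; module ≡-Reasoning)
open import Relation.Nullary using (¬_; yes; no)

Independent : Formula → BES → Set
Independent f ℰ = ∀ Y → Y ∈ occ f → Y ∉ bnd ℰ

update-cong : ∀ {η η′} X b → η ≗ η′ → η [ X ≔ b ] ≗ η′ [ X ≔ b ]
update-cong X b η≗η′ Y with Y ≟ X
... | yes _ = refl
... | no  _ = η≗η′ Y

update-≢ : ∀ η X b {Y} → ¬ Y ≡ X → (η [ X ≔ b ]) Y ≡ η Y
update-≢ η X b {Y} Y≢X with Y ≟ X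
... | yes Y≡X = ⊥-elim (Y≢X Y≡X)
... | no  _   = refl

update-comm : ∀ η Z a X b → ¬ Z ≡ X → (η [ Z ≔ a ]) [ X ≔ b ] ≗ (η [ X ≔ b ]) [ Z ≔ a ]
update-comm η Z a X b Z≢X Y with Y ≟ X | Y ≟ Z
... | yes refl | yes refl = ⊥-elim (Z≢X refl)
... | yes _    | no  _    = refl
... | no  _    | yes _    = refl
... | no  _    | no  _    = refl

formula-cong : ∀ f {η η′} → (∀ Y → Y ∈ occ f → η Y ≡ η′ Y) → ⟦ f ⟧ᶠ η ≡ ⟦ f ⟧ᶠ η′
formula-cong ftrue    _  = refl
formula-cong ffalse   _  = refl
formula-cong (fvar X) agree = agree X (here refl)
formula-cong (f ∨ᶠ g) agree = cong₂ _∨_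
  (formula-cong f (λ Y p → agree Y (∈-++⁺ˡ p)))
  (formula-cong g (λ Y p → agree Y (∈-++⁺ʳ (occ f) p)))
formula-cong (f ∧ᶠ g) agree = cong₂ _∧_
  (formula-cong f (λ Y p → agree Y (∈-++⁺ˡ p)))
  (formula-cong g (λ Y p → agree Y (∈-++⁺ʳ (occ f) p)))

formula-update-irrelevant : ∀ f η Z a → Z ∉ occ f → ⟦ f ⟧ᶠ (η [ Z ≔ a ]) ≡ ⟦ f ⟧ᶠ η
formula-update-irrelevant f η Z a Z∉f =
  formula-cong f (λ Y p → update-≢ η Z a (λ Y≡Z → Z∉f (subst (_∈ occ f) Y≡Z p)))

system-cong : ∀ ℰ {η η′} → η ≗ η′ → ⟦ ℰ ⟧ η ≗ ⟦ ℰ ⟧ η′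
system-cong [] η≗η′ = η≗η′
system-cong (eqn σ X f ∷ ℰ) {η} {η′} η≗η′ = system-cong ℰ (λ Y →
  trans (update-cong X _ η≗η′ Y)
        (cong (λ b → (η′ [ X ≔ b ]) Y)
              (formula-cong f (λ Z _ → system-cong ℰ (update-cong X (init σ) η≗η′) Z))))

system-frame : ∀ ℰ η {Y} → Y ∉ bnd ℰ → ⟦ ℰ ⟧ η Y ≡ η Y
system-frame []              η Y∉ℰ = refl
system-frame (eqn σ X f ∷ ℰ) η Y∉ℰ =
  trans (system-frame ℰ _ (λ p → Y∉ℰ (there p))) (update-≢ η X _ (λ Y≡X → Y∉ℰ (here Y≡X)))

formula-system-irrelevant : ∀ f ℰ η → Independent f ℰ → ⟦ f ⟧ᶠ (⟦ ℰ ⟧ η) ≡ ⟦ f ⟧ᶠ η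
formula-system-irrelevant f ℰ η indep = formula-cong f (λ Y p → system-frame ℰ η (indep Y p))

prefix-cong : ∀ ℰ₀ {ℰ ℰ′} → (∀ η → ⟦ ℰ ⟧ η ≗ ⟦ ℰ′ ⟧ η) → ∀ η → ⟦ ℰ₀ ++ ℰ ⟧ η ≗ ⟦ ℰ₀ ++ ℰ′ ⟧ η
prefix-cong []              same = same
prefix-cong (eqn σ Z g ∷ ℰ₀) {ℰ′ = ℰ′} same η Y =
  trans (prefix-cong ℰ₀ same _ Y)
        (cong (λ b → ⟦ ℰ₀ ++ ℰ′ ⟧ (η [ Z ≔ b ]) Y)
              (formula-cong g (λ W _ → prefix-cong ℰ₀ same _ W)))

independent-head : ∀ σ X f ℰ η → X ∉ occ f → Independent f ℰ
  → ⟦ eqn σ X f ∷ ℰ ⟧ η ≗ ⟦ ℰ ⟧ (η [ X ≔ ⟦ f ⟧ᶠ η ])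
independent-head σ X f ℰ η X∉f indep =
  system-cong ℰ (λ Y → cong (λ b → (η [ X ≔ b ]) Y) value-of-f)
  where
  value-of-f : ⟦ f ⟧ᶠ (⟦ ℰ ⟧ (η [ X ≔ init σ ])) ≡ ⟦ f ⟧ᶠ η
  value-of-f = trans (formula-system-irrelevant f ℰ _ indep)
                     (formula-update-irrelevant f η X (init σ) X∉f)

-- The same holds after a prefix ℰ₁ that binds neither X nor a variable of f:
-- the equation may be floated to the front, where independent-head applies.
independent-float : ∀ σ X f ℰ₁ ℰ₂ η → X ∉ bnd (ℰ₁ ++ ℰ₂) → X ∉ occ f → Independent f (ℰ₁ ++ ℰ₂)
  → ⟦ ℰ₁ ++ (eqn σ X f ∷ ℰ₂) ⟧ η ≗ ⟦ ℰ₁ ++ ℰ₂ ⟧ (η [ X ≔ ⟦ f ⟧ᶠ η ])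
independent-float σ X f [] ℰ₂ η _ X∉f indep = independent-head σ X f ℰ₂ η X∉f indep
independent-float σ X f (eqn ρ Z g ∷ ℰ₁) ℰ₂ η X∉ X∉f indep Y =
  begin
    ⟦ ℰ₁ ++ (eqn σ X f ∷ ℰ₂) ⟧ (η [ Z ≔ ⟦ g ⟧ᶠ (⟦ ℰ₁ ++ (eqn σ X f ∷ ℰ₂) ⟧ (η [ Z ≔ init ρ ])) ]) Y
  ≡⟨ shifted _ Y ⟩
    ⟦ ℰ₁ ++ ℰ₂ ⟧ ((η [ X ≔ v ]) [ Z ≔ ⟦ g ⟧ᶠ (⟦ ℰ₁ ++ (eqn σ X f ∷ ℰ₂) ⟧ (η [ Z ≔ init ρ ])) ]) Y
  ≡⟨ cong (λ b → ⟦ ℰ₁ ++ ℰ₂ ⟧ ((η [ X ≔ v ]) [ Z ≔ b ]) Y)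
          (formula-cong g (λ W _ → shifted (init ρ) W)) ⟩
    ⟦ ℰ₁ ++ ℰ₂ ⟧ ((η [ X ≔ v ]) [ Z ≔ ⟦ g ⟧ᶠ (⟦ ℰ₁ ++ ℰ₂ ⟧ ((η [ X ≔ v ]) [ Z ≔ init ρ ])) ]) Y
  ∎
  where
  open ≡-Reasoning
  v : Bool
  v = ⟦ f ⟧ᶠ η
  Z≢X : ¬ Z ≡ X
  Z≢X Z≡X = X∉ (here (sym Z≡X))
  Z∉f : Z ∉ occ f
  Z∉f p = indep Z p (here refl)
  -- After setting Z, the floated equation still contributes X ≔ v (Z ∉ occ f),
  -- and the two updates commute (Z ≠ X).
  shifted : ∀ a → ⟦ ℰ₁ ++ (eqn σ X f ∷ ℰ₂) ⟧ (η [ Z ≔ a ]) ≗ ⟦ ℰ₁ ++ ℰ₂ ⟧ ((η [ X ≔ v ]) [ Z ≔ a ])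
  shifted a W = trans
    (independent-float σ X f ℰ₁ ℰ₂ (η [ Z ≔ a ]) (λ p → X∉ (there p)) X∉f
                       (λ U p q → indep U p (there q)) W)
    (system-cong (ℰ₁ ++ ℰ₂) (λ V →
       trans (cong (λ b → ((η [ Z ≔ a ]) [ X ≔ b ]) V) (formula-update-irrelevant f η Z a Z∉f))
             (update-comm η Z a X v Z≢X V)) W)

suffix-wellFormed : ∀ ℰ₀ {ℰ} → WellFormed (ℰ₀ ++ ℰ) → WellFormed ℰ
suffix-wellFormed []            wf       = wf
suffix-wellFormed (_ ∷ ℰ₀)     (_ ∷ wf) = suffix-wellFormed ℰ₀ wf

head-not-rebound : ∀ σ X f ℰ → WellFormed (eqn σ X f ∷ ℰ) → X ∉ bnd ℰ
head-not-rebound σ X f ℰ (X≢later ∷ _) = All¬⇒¬Any X≢later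

mainTheorem1 : (ℰ₀ ℰ₁ ℰ₂ : BES) (σ σ′ : Sign) (X : Var) (f : Formula)
    → WellFormed (ℰ₀ ++ (eqn σ X f ∷ ℰ₁) ++ ℰ₂)
    → WellFormed (ℰ₀ ++ ℰ₁ ++ (eqn σ′ X f ∷ ℰ₂))
    → (∀ Y → Y ∈ occ f → Y ∉ bnd ((eqn σ X f ∷ ℰ₁) ++ ℰ₂))
    → ∀ (η : Env) (Y : Var)
    → ⟦ ℰ₀ ++ (eqn σ X f ∷ ℰ₁) ++ ℰ₂ ⟧ η Y ≡ ⟦ ℰ₀ ++ ℰ₁ ++ (eqn σ′ X f ∷ ℰ₂) ⟧ η Y
mainTheorem1 ℰ₀ ℰ₁ ℰ₂ σ σ′ X f wf _ independent = prefix-cong ℰ₀ move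
  where
  X∉ : X ∉ bnd (ℰ₁ ++ ℰ₂)
  X∉ = head-not-rebound σ X f (ℰ₁ ++ ℰ₂) (suffix-wellFormed ℰ₀ wf)
  X∉f : X ∉ occ f
  X∉f p = independent X p (here refl)
  indep : Independent f (ℰ₁ ++ ℰ₂)
  indep Y p q = independent Y p (there q)
  move : ∀ η → ⟦ eqn σ X f ∷ ℰ₁ ++ ℰ₂ ⟧ η ≗ ⟦ ℰ₁ ++ (eqn σ′ X f ∷ ℰ₂) ⟧ η
  move η Y = trans (independent-head σ X f (ℰ₁ ++ ℰ₂) η X∉f indep Y)
                   (sym (independent-float σ′ X f ℰ₁ ℰ₂ η X∉ X∉f indep Y))
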